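{- Let $t$ be a positive integer and let $\mathcal{A}$ be a finite family of finite sets with $|\mathcal{A}| > 1$, and let $r$ be the size of a largest set in $\mathcal{A}$. If $\mathcal{A}$ is not a trivial $t$-intersecting family, then, for some $p \geq 2$, there exist $A_1, \dots, A_p \in \mathcal{A}$ such that $|\bigcup_{i=1}^p A_i| \leq m(r,t)$ and every $t$-transversal of $\mathcal{A}$ $(t+1)$-intersects $\bigcup_{i=1}^p A_i$.
   Context: A set $A$ $t$-intersects a set $B$ if $|A \cap B| \ge t$. A family $\mathcal{A}$ is $t$-intersecting if every $A, B \in \mathcal{A}$ $t$-intersect; it is a trivial $t$-intersecting family if it is $t$-intersecting and $|\bigcap_{A \in \mathcal{A}} A| \geq t$. A $t$-transversal of $\mathcal{A}$ is a set that $t$-intersects each set in $\mathcal{A}$. Define $m(r,t) := \max\{2r, \frac{(r-t)(r-t+5)}{2} + (t-1)\}$. -}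

module Defs where

open import Data.Nat as ℕ using (ℕ; suc; _≤_)
open import Data.Integer as ℤ using (ℤ; +_; _-_; _*_; _⊔_; _/ℕ_)
open import Data.Fin.Subset using (Subset; _∩_; ⋂; ∣_∣)
open import Data.List using (List; foldr)
open import Data.List.Relation.Unary.All using (All)
open import Data.List.Membership.Propositional using (_∈_)

TIntersects : {n : ℕ} → ℕ → Subset n → Subset n → Set
TIntersects t A B = t ≤ ∣ A ∩ B ∣

TIntersecting : {n : ℕ} → ℕ → List (Subset n) → Set
TIntersecting t 𝒜 = ∀ {A B} → A ∈ 𝒜 → B ∈ 𝒜 → TIntersects t A B

TrivialTIntersecting : {n : ℕ} → ℕ → List (Subset n) → Set
TrivialTIntersecting t 𝒜 = TIntersecting t 𝒜 × (t ≤ ∣ ⋂ 𝒜 ∣)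
  where open import Data.Product using (_×_)

Transversal : {n : ℕ} → ℕ → List (Subset n) → Subset n → Set
Transversal t 𝒜 T = All (TIntersects t T) 𝒜

maxSize : {n : ℕ} → List (Subset n) → ℕ
maxSize = foldr (λ A k → ∣ A ∣ ℕ.⊔ k) 0

-- m(r,t) = max{2r, (r-t)(r-t+5)/2 + (t-1)}, computed in ℤ
-- ((r-t)(r-t+5) is always even, so the division by 2 is exact)
m : ℕ → ℕ → ℤ
m r t = (+ (2 ℕ.* r)) ⊔ (((x * (x ℤ.+ + 5)) /ℕ 2) ℤ.+ (+ t - + 1))
  where x = + r - + t

module Submission where

-- Write 𝒜 = A₁ ∷ rest and r = maxSize 𝒜.  Everything rests on one
-- set-theoretic observation (transversal-gains): if T t-intersects every member of a
-- nonempty list L while |⋂ L| < t, then T (t+1)-intersects ⋃ L, because otherwise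
-- T ∩ ⋃ L would be contained in every T ∩ C, hence in ⋂ L.  So it suffices to exhibit
-- at least two members of 𝒜 whose intersection is small and whose union is small.
--  * If 𝒜 is not t-intersecting, two members A, B with |A ∩ B| < t do the job; their
--    union has at most 2r elements.
--  * If 𝒜 is t-intersecting, let B₁ minimise c = |B ∩ A₁| (so c ≥ t), start from
--    [B₁, A₁] and greedily prepend members of 𝒜 that strictly shrink the common
--    intersection until it has fewer than t elements (greedy-shrink); at most c - t + 1
--    sets are added.  Each added set meets A₁ in at least c points and so contributes at
--    most r - c new points (union-growth).  The resulting estimate
--    |⋃ L| ≤ r + (c - t + 2)(r - c) is at most m(r,t) by elementary arithmetic.

open import Defs
open import Data.Nat using (ℕ; zero; suc; _+_; _*_; _∸_; _/_; _≤_; _<_; _≤?_; _<?_; z≤n; s≤s; s≤s⁻¹)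
open import Data.Nat.Properties
open import Data.Nat.DivMod using (m*n/n≡m; /-monoˡ-≤)
open import Data.Nat.Induction using (<-wellFounded)
open import Data.Nat.Tactic.RingSolver using (solve-∀)
open import Data.Integer as ℤ using (+_; +≤+) renaming (_≤_ to _≤ℤ_; _⊔_ to _⊔ℤ_)
open import Data.Integer.Properties using (⊖-≥; pos-*; pos-+; i≤j⇒i≤j⊔k; i≤j⇒i≤k⊔j)
open import Data.Vec using (_∷_; []; here)
open import Data.Fin.Subset using (Subset; ⋃; ⋂; ∣_∣; _∩_; _∪_; ⊥; _⊆_; inside; outside)
open import Data.Fin.Subset.Properties
  using (p⊆q⇒∣p∣≤∣q∣; drop-∷-⊆; s⊆s; ⊆-trans; x∈p∩q⁺; x∈p∩q⁻; p∩q⊆p; p∩q⊆q; p⊆p∪q; q⊆p∪q; ∈⊤; ∣⊥∣≡0; ∩-identityʳ; ∪-identityʳ)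
open import Data.List using (List; []; _∷_; _++_; length)
open import Data.List.Properties using (++-assoc; length-++)
open import Data.List.Relation.Unary.All as All using (All; []; _∷_; all?)
open import Data.List.Relation.Unary.All.Properties using (¬All⇒Any¬; ¬Any⇒All¬; ++⁺)
open import Data.List.Relation.Unary.Any using (Any; here; there; any?)
open import Data.List.Relation.Unary.Unique.Propositional using (Unique)
open import Data.List.Membership.Propositional using (_∈_; find)
open import Data.List.Membership.Propositional.Properties using (∈-++⁺ʳ)
open import Data.List.Extrema.Nat using (argmin; argmin-all; f[argmin]≤f[⊤]; f[argmin]≤f[xs])
open import Data.Product using (Σ; ∃-syntax; _×_; _,_)
open import Data.Sum using (_⊎_; inj₁; inj₂)
open import Induction.WellFounded using (Acc; acc)
open import Relation.Nullary using (¬_; yes; no; contradiction)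
open import Relation.Binary.PropositionalEquality using (_≡_; refl; sym; trans; cong; subst)

∣p∪q∣+∣p∩q∣ : ∀ {n} (p q : Subset n) → ∣ p ∪ q ∣ + ∣ p ∩ q ∣ ≡ ∣ p ∣ + ∣ q ∣
∣p∪q∣+∣p∩q∣ [] [] = refl
∣p∪q∣+∣p∩q∣ (inside ∷ p) (inside ∷ q) =
  cong suc (trans (+-suc _ _) (trans (cong suc (∣p∪q∣+∣p∩q∣ p q)) (sym (+-suc _ _))))
∣p∪q∣+∣p∩q∣ (inside ∷ p) (outside ∷ q) = cong suc (∣p∪q∣+∣p∩q∣ p q)
∣p∪q∣+∣p∩q∣ (outside ∷ p) (inside ∷ q) = trans (cong suc (∣p∪q∣+∣p∩q∣ p q)) (sym (+-suc _ _))
∣p∪q∣+∣p∩q∣ (outside ∷ p) (outside ∷ q) = ∣p∪q∣+∣p∩q∣ p q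

⊆-by-size : ∀ {n} {p q : Subset n} → p ⊆ q → ∣ q ∣ ≤ ∣ p ∣ → q ⊆ p
⊆-by-size {p = []} {[]} p⊆q q≤p ()
⊆-by-size {p = inside ∷ p} {inside ∷ q} p⊆q q≤p = s⊆s (⊆-by-size (drop-∷-⊆ p⊆q) (s≤s⁻¹ q≤p))
⊆-by-size {p = outside ∷ p} {outside ∷ q} p⊆q q≤p = s⊆s (⊆-by-size (drop-∷-⊆ p⊆q) q≤p)
⊆-by-size {p = outside ∷ p} {inside ∷ q} p⊆q q≤p =
  contradiction (≤-trans q≤p (p⊆q⇒∣p∣≤∣q∣ (drop-∷-⊆ p⊆q))) (<⇒≱ ≤-refl)
⊆-by-size {p = inside ∷ p} {outside ∷ q} p⊆q q≤p = contradiction (p⊆q here) λ ()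

∩-monoʳ-⊆ : ∀ {n} (T : Subset n) {C U : Subset n} → C ⊆ U → T ∩ C ⊆ T ∩ U
∩-monoʳ-⊆ T {C} C⊆U x∈ with x∈p∩q⁻ T C x∈
... | x∈T , x∈C = x∈p∩q⁺ (x∈T , C⊆U x∈C)

⊆-⋂ : ∀ {n} {I : Subset n} (L : List (Subset n)) → (∀ {C} → C ∈ L → I ⊆ C) → I ⊆ ⋂ L
⊆-⋂ [] I⊆ x∈ = ∈⊤
⊆-⋂ (C ∷ L) I⊆ x∈ = x∈p∩q⁺ (I⊆ (here refl) x∈ , ⊆-⋂ L (λ C∈ → I⊆ (there C∈)) x∈)

∈⇒⊆-⋃ : ∀ {n} {C : Subset n} (L : List (Subset n)) → C ∈ L → C ⊆ ⋃ L
∈⇒⊆-⋃ (C ∷ L) (here refl) = p⊆p∪q (⋃ L)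
∈⇒⊆-⋃ (D ∷ L) (there C∈) x∈ = q⊆p∪q D (⋃ L) (∈⇒⊆-⋃ L C∈ x∈)

∣⋂-pair∣ : ∀ {n} (A B : Subset n) → ∣ ⋂ (A ∷ B ∷ []) ∣ ≡ ∣ A ∩ B ∣
∣⋂-pair∣ A B = cong (λ X → ∣ A ∩ X ∣) (∩-identityʳ B)

∣⋃∣≤length*r : ∀ {n} {r} (L : List (Subset n)) → All (λ A → ∣ A ∣ ≤ r) L → ∣ ⋃ L ∣ ≤ length L * r
∣⋃∣≤length*r {n} [] [] = ≤-reflexive (∣⊥∣≡0 n)
∣⋃∣≤length*r (A ∷ L) (A≤r ∷ L≤r) = begin
  ∣ A ∪ ⋃ L ∣                ≤⟨ m≤m+n _ _ ⟩
  ∣ A ∪ ⋃ L ∣ + ∣ A ∩ ⋃ L ∣   ≡⟨ ∣p∪q∣+∣p∩q∣ A (⋃ L) ⟩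
  ∣ A ∣ + ∣ ⋃ L ∣             ≤⟨ +-mono-≤ A≤r (∣⋃∣≤length*r L L≤r) ⟩
  _                          ∎
  where open ≤-Reasoning

maxSize-bound : ∀ {n} (𝒜 : List (Subset n)) {A} → A ∈ 𝒜 → ∣ A ∣ ≤ maxSize 𝒜
maxSize-bound (A ∷ 𝒜) (here refl) = m≤m⊔n _ _
maxSize-bound (B ∷ 𝒜) (there A∈) = ≤-trans (maxSize-bound 𝒜 A∈) (m≤n⊔m ∣ B ∣ _)

transversal-gains : ∀ {n} {t} {A} (T : Subset n) (L : List (Subset n)) → A ∈ L →
  All (TIntersects t T) L → ∣ ⋂ L ∣ < t → TIntersects (suc t) T (⋃ L)
transversal-gains {t = t} {A} T L A∈L meets small with suc t ≤? ∣ T ∩ ⋃ L ∣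
... | yes gains = gains
... | no ¬gains = contradiction (begin-strict
  t                  ≤⟨ All.lookup meets A∈L ⟩
  ∣ T ∩ A ∣          ≤⟨ p⊆q⇒∣p∣≤∣q∣ (∩-monoʳ-⊆ T (∈⇒⊆-⋃ L A∈L)) ⟩
  ∣ T ∩ ⋃ L ∣        ≤⟨ p⊆q⇒∣p∣≤∣q∣ (⊆-⋂ L inside-each) ⟩
  ∣ ⋂ L ∣            <⟨ small ⟩
  t                  ∎) (<-irrefl refl)
  where
  open ≤-Reasoning
  few : ∣ T ∩ ⋃ L ∣ ≤ t
  few = s≤s⁻¹ (≰⇒> ¬gains)
  -- T ∩ ⋃ L ⊆ T ∩ C, and it is no larger than T ∩ C, so the two coincide.
  inside-each : ∀ {C} → C ∈ L → T ∩ ⋃ L ⊆ C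
  inside-each {C} C∈L = ⊆-trans
    (⊆-by-size (∩-monoʳ-⊆ T (∈⇒⊆-⋃ L C∈L)) (≤-trans few (All.lookup meets C∈L)))
    (p∩q⊆q T C)

shrinking-member : ∀ {n} (𝒜 : List (Subset n)) (I : Subset n) →
  ∣ ⋂ 𝒜 ∣ < ∣ I ∣ → Any (λ B → ∣ B ∩ I ∣ < ∣ I ∣) 𝒜
shrinking-member 𝒜 I larger with any? (λ B → ∣ B ∩ I ∣ <? ∣ I ∣) 𝒜
... | yes cut = cut
... | no ¬cut = contradiction (p⊆q⇒∣p∣≤∣q∣ (⊆-⋂ 𝒜 I⊆)) (<⇒≱ larger)
  where
  I⊆ : ∀ {B} → B ∈ 𝒜 → I ⊆ B
  I⊆ {B} B∈𝒜 = ⊆-trans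
    (⊆-by-size (p∩q⊆q B I) (≮⇒≥ (All.lookup (¬Any⇒All¬ 𝒜 ¬cut) B∈𝒜)))
    (p∩q⊆p B I)

greedy-shrink : ∀ {n} {t} (𝒜 : List (Subset n)) → ∣ ⋂ 𝒜 ∣ < t →
  (L₀ : List (Subset n)) → t ≤ ∣ ⋂ L₀ ∣ →
  ∃[ Bs ] All (_∈ 𝒜) Bs × ∣ ⋂ (Bs ++ L₀) ∣ < t × length Bs + t ≤ suc ∣ ⋂ L₀ ∣
greedy-shrink {n} {t} 𝒜 small L₀ t≤L₀ = go L₀ t≤L₀ (<-wellFounded ∣ ⋂ L₀ ∣)
  where
  go : (L : List (Subset n)) → t ≤ ∣ ⋂ L ∣ → Acc _<_ ∣ ⋂ L ∣ →
    ∃[ Bs ] All (_∈ 𝒜) Bs × ∣ ⋂ (Bs ++ L) ∣ < t × length Bs + t ≤ suc ∣ ⋂ L ∣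
  go L t≤L (acc smaller) with find (shrinking-member 𝒜 (⋂ L) (<-≤-trans small t≤L))
  ... | B , B∈𝒜 , cut with ∣ B ∩ ⋂ L ∣ <? t
  ...   | yes done = B ∷ [] , B∈𝒜 ∷ [] , done , s≤s t≤L
  ...   | no ¬done with go (B ∷ L) (≮⇒≥ ¬done) (smaller cut)
  ...     | Bs , Bs⊆𝒜 , below , count =
    Bs ++ B ∷ [] , ++⁺ Bs⊆𝒜 (B∈𝒜 ∷ []) ,
    subst (λ X → ∣ ⋂ X ∣ < t) (sym (++-assoc Bs (B ∷ []) L)) below , count′
    where
    open ≤-Reasoning
    count′ : length (Bs ++ B ∷ []) + t ≤ suc ∣ ⋂ L ∣
    count′ = begin
      length (Bs ++ B ∷ []) + t  ≡⟨ cong (_+ t) (trans (length-++ Bs) (+-comm (length Bs) 1)) ⟩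
      suc (length Bs + t)        ≤⟨ s≤s count ⟩
      suc (suc ∣ B ∩ ⋂ L ∣)      ≤⟨ s≤s cut ⟩
      suc ∣ ⋂ L ∣                ∎

union-step : ∀ {n} {r c} (B U : Subset n) → ∣ B ∣ ≤ r → c ≤ ∣ B ∩ U ∣ → ∣ B ∪ U ∣ + c ≤ r + ∣ U ∣
union-step {c = c} B U B≤r c≤B∩U = begin
  ∣ B ∪ U ∣ + c          ≤⟨ +-monoʳ-≤ ∣ B ∪ U ∣ c≤B∩U ⟩
  ∣ B ∪ U ∣ + ∣ B ∩ U ∣  ≡⟨ ∣p∪q∣+∣p∩q∣ B U ⟩
  ∣ B ∣ + ∣ U ∣          ≤⟨ +-monoˡ-≤ ∣ U ∣ B≤r ⟩
  _                      ∎
  where open ≤-Reasoning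

union-growth : ∀ {n} {r c} {W : Subset n} (Bs L₀ : List (Subset n)) → W ∈ L₀ →
  All (λ B → ∣ B ∣ ≤ r × c ≤ ∣ B ∩ W ∣) Bs →
  ∣ ⋃ (Bs ++ L₀) ∣ + length Bs * c ≤ ∣ ⋃ L₀ ∣ + length Bs * r
union-growth [] L₀ W∈L₀ [] = ≤-refl
union-growth {n} {r} {c} (B ∷ Bs) L₀ W∈L₀ ((B≤r , c≤B∩W) ∷ rest) = begin
  ∣ B ∪ U ∣ + (c + j * c)      ≡⟨ +-assoc ∣ B ∪ U ∣ c (j * c) ⟨
  ∣ B ∪ U ∣ + c + j * c        ≤⟨ +-monoˡ-≤ (j * c) (union-step B U B≤r c≤B∩U) ⟩
  r + ∣ U ∣ + j * c            ≡⟨ +-assoc r ∣ U ∣ (j * c) ⟩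
  r + (∣ U ∣ + j * c)          ≤⟨ +-monoʳ-≤ r (union-growth Bs L₀ W∈L₀ rest) ⟩
  r + (∣ ⋃ L₀ ∣ + j * r)       ≡⟨ x+[y+z]≡y+[x+z] r ∣ ⋃ L₀ ∣ (j * r) ⟩
  ∣ ⋃ L₀ ∣ + (r + j * r)       ∎
  where
  open ≤-Reasoning
  U : Subset n
  U = ⋃ (Bs ++ L₀)
  j : ℕ
  j = length Bs
  c≤B∩U : c ≤ ∣ B ∩ U ∣
  c≤B∩U = ≤-trans c≤B∩W (p⊆q⇒∣p∣≤∣q∣ (∩-monoʳ-⊆ B (∈⇒⊆-⋃ (Bs ++ L₀) (∈-++⁺ʳ Bs W∈L₀))))
  x+[y+z]≡y+[x+z] : ∀ x y z → x + (y + z) ≡ y + (x + z)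
  x+[y+z]≡y+[x+z] = solve-∀

r-t≡a+e : ∀ t a e → + (t + a + e) ℤ.- + t ≡ + (a + e)
r-t≡a+e zero a e = cong +_ (+-identityʳ (a + e))
r-t≡a+e (suc t′) a e = trans (⊖-≥ (≤-trans (m≤m+n (suc t′) a) (m≤m+n _ e)))
  (cong +_ (trans (cong (_∸ suc t′) (+-assoc (suc t′) a e)) (m+n∸m≡n (suc t′) (a + e))))

m-closed-form : ∀ t′ a e →
  m (suc t′ + a + e) (suc t′) ≡ + (2 * (suc t′ + a + e)) ⊔ℤ + ((a + e) * (a + e + 5) / 2 + t′)
m-closed-form t′ a e rewrite r-t≡a+e (suc t′) a e | sym (pos-* (a + e) (a + e + 5)) =
  cong (+ (2 * (suc t′ + a + e)) ⊔ℤ_) (sym (pos-+ ((a + e) * (a + e + 5) / 2) t′))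

halve : ∀ N P s → 2 * N ≤ P + 2 * s → N ≤ P / 2 + s
halve N P s 2N≤ = begin
  N                ≤⟨ m≤n+m∸n N s ⟩
  s + (N ∸ s)      ≡⟨ +-comm s (N ∸ s) ⟩
  (N ∸ s) + s      ≤⟨ +-monoˡ-≤ s half ⟩
  P / 2 + s        ∎
  where
  open ≤-Reasoning
  twice : (N ∸ s) * 2 ≤ P
  twice = begin
    (N ∸ s) * 2      ≡⟨ *-comm (N ∸ s) 2 ⟩
    2 * (N ∸ s)      ≡⟨ *-distribˡ-∸ 2 N s ⟩
    2 * N ∸ 2 * s    ≤⟨ m≤n+o⇒m∸n≤o (2 * N) (2 * s) (≤-trans 2N≤ (≤-reflexive (+-comm P (2 * s)))) ⟩
    P                ∎
  half : N ∸ s ≤ P / 2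
  half = ≤-trans (≤-reflexive (sym (m*n/n≡m (N ∸ s) 2))) (/-monoˡ-≤ 2 twice)

quadratic-regime : ∀ N t′ a e D →
  2 * (suc t′ + a + e + (a + 2) * e) + D ≡ (a + e) * (a + e + 5) + 2 * t′ →
  N ≤ suc t′ + a + e + (a + 2) * e → N ≤ (a + e) * (a + e + 5) / 2 + t′
quadratic-regime N t′ a e D slack N≤ =
  halve N ((a + e) * (a + e + 5)) t′ (≤-trans (*-monoʳ-≤ 2 N≤) (≤-trans (m≤m+n _ D) (≤-reflexive slack)))

-- r + (a+2)e ≤ max(2r, x(x+5)/2 + t′) for r = 1 + t′ + a + e and x = a + e: the linear
-- term wins only when a = 0 and e ≤ 1, otherwise an explicit slack is exhibited.
chain-bound : ∀ N t′ a e → N ≤ suc t′ + a + e + (a + 2) * e →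
  N ≤ 2 * (suc t′ + a + e) ⊎ N ≤ (a + e) * (a + e + 5) / 2 + t′
chain-bound N t′ zero zero N≤ = inj₁ (≤-trans N≤ (≤-trans (m≤m+n _ (suc t′)) (≤-reflexive (linear₀ t′))))
  where
  linear₀ : ∀ t′ → suc t′ + 0 + 0 + (0 + 2) * 0 + suc t′ ≡ 2 * (suc t′ + 0 + 0)
  linear₀ = solve-∀
chain-bound N t′ zero (suc zero) N≤ = inj₁ (≤-trans N≤ (≤-trans (m≤m+n _ t′) (≤-reflexive (linear₁ t′))))
  where
  linear₁ : ∀ t′ → suc t′ + 0 + 1 + (0 + 2) * 1 + t′ ≡ 2 * (suc t′ + 0 + 1)
  linear₁ = solve-∀
chain-bound N t′ zero (suc (suc e)) N≤ = inj₂ (quadratic-regime N t′ 0 (suc (suc e)) (e * e + 3 * e) (slack t′ e) N≤)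
  where
  slack : ∀ t′ e → 2 * (suc t′ + 0 + suc (suc e) + (0 + 2) * suc (suc e)) + (e * e + 3 * e)
                 ≡ (0 + suc (suc e)) * (0 + suc (suc e) + 5) + 2 * t′
  slack = solve-∀
chain-bound N t′ (suc a) zero N≤ = inj₂ (quadratic-regime N t′ (suc a) 0 (a * a + 5 * a + 2) (slack t′ a) N≤)
  where
  slack : ∀ t′ a → 2 * (suc t′ + suc a + 0 + (suc a + 2) * 0) + (a * a + 5 * a + 2)
                 ≡ (suc a + 0) * (suc a + 0 + 5) + 2 * t′
  slack = solve-∀
chain-bound N t′ (suc a) (suc e) N≤ =
  inj₂ (quadratic-regime N t′ (suc a) (suc e) (a * a + 5 * a + 2 + e * e + e) (slack t′ a e) N≤)
  where
  slack : ∀ t′ a e → 2 * (suc t′ + suc a + suc e + (suc a + 2) * suc e) + (a * a + 5 * a + 2 + e * e + e)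
                   ≡ (suc a + suc e) * (suc a + suc e + 5) + 2 * t′
  slack = solve-∀

chain-estimate : ∀ {N U j} t a e → j + t ≤ suc (t + a) →
  N + j * (t + a) ≤ U + j * (t + a + e) → U + (t + a) ≤ (t + a + e) + (t + a + e) →
  N ≤ t + a + e + (a + 2) * e
chain-estimate {N} {U} {j} t a e count growth base = +-cancelʳ-≤ (suc j * c) N _ (begin
  N + suc j * c              ≡⟨ unfold N j c ⟩
  N + j * c + c              ≤⟨ +-monoˡ-≤ c growth ⟩
  U + j * r + c              ≡⟨ swap U (j * r) c ⟩
  U + c + j * r              ≤⟨ +-monoˡ-≤ (j * r) base ⟩
  r + r + j * r              ≡⟨ regroup t a e j ⟩
  r + suc j * e + suc j * c  ≤⟨ +-monoˡ-≤ (suc j * c) (+-monoʳ-≤ r (*-monoˡ-≤ e j≤a+2)) ⟩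
  r + (a + 2) * e + suc j * c ∎)
  where
  open ≤-Reasoning
  c r : ℕ
  c = t + a
  r = t + a + e
  j≤a+2 : suc j ≤ a + 2
  j≤a+2 = +-cancelʳ-≤ t (suc j) (a + 2) (≤-trans (s≤s count) (≤-reflexive (shift t a)))
    where
    shift : ∀ t a → suc (suc (t + a)) ≡ a + 2 + t
    shift = solve-∀
  unfold : ∀ N j c → N + suc j * c ≡ N + j * c + c
  unfold = solve-∀
  swap : ∀ x y z → x + y + z ≡ x + z + y
  swap = solve-∀
  regroup : ∀ t a e j → t + a + e + (t + a + e) + j * (t + a + e)
                      ≡ t + a + e + suc j * e + suc j * (t + a)
  regroup = solve-∀

size-bound : ∀ {N U j c r t} → 1 ≤ t → t ≤ c → c ≤ r → j + t ≤ suc c →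
  N + j * c ≤ U + j * r → U + c ≤ r + r → + N ≤ℤ m r t
size-bound {N} {t = suc t′} _ t≤c c≤r count growth base
  with m≤n⇒∃[o]m+o≡n t≤c
... | a , refl with m≤n⇒∃[o]m+o≡n c≤r
... | e , refl rewrite m-closed-form t′ a e
  with chain-bound N t′ a e (chain-estimate (suc t′) a e count growth base)
... | inj₁ N≤2r = i≤j⇒i≤j⊔k (+ ((a + e) * (a + e + 5) / 2 + t′)) (+≤+ N≤2r)
... | inj₂ N≤quadratic = i≤j⇒i≤k⊔j (+ (2 * (suc t′ + a + e))) (+≤+ N≤quadratic)

GoodSubfamily : ∀ {n} → ℕ → List (Subset n) → List (Subset n) → Set
GoodSubfamily {n} t 𝒜 As = 2 ≤ length As × All (_∈ 𝒜) As
  × (+ ∣ ⋃ As ∣ ≤ℤ m (maxSize 𝒜) t)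
  × ((T : Subset n) → Transversal t 𝒜 T → TIntersects (suc t) T (⋃ As))

intersecting-or-witness : ∀ {n} t (𝒜 : List (Subset n)) →
  TIntersecting t 𝒜 ⊎ ∃[ A ] ∃[ B ] A ∈ 𝒜 × B ∈ 𝒜 × ∣ A ∩ B ∣ < t
intersecting-or-witness t 𝒜 with all? (λ A → all? (λ B → t ≤? ∣ A ∩ B ∣) 𝒜) 𝒜
... | yes pairwise = inj₁ (λ A∈𝒜 B∈𝒜 → All.lookup (All.lookup pairwise A∈𝒜) B∈𝒜)
... | no ¬pairwise with find (¬All⇒Any¬ (λ A → all? (λ B → t ≤? ∣ A ∩ B ∣) 𝒜) 𝒜 ¬pairwise)
... | A , A∈𝒜 , ¬A-row with find (¬All⇒Any¬ (λ B → t ≤? ∣ A ∩ B ∣) 𝒜 ¬A-row)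
... | B , B∈𝒜 , ¬A∩B = inj₂ (A , B , A∈𝒜 , B∈𝒜 , ≰⇒> ¬A∩B)

minimiser : ∀ {X : Set} (f : X → ℕ) (x : X) (xs : List X) →
  ∃[ y ] y ∈ x ∷ xs × (∀ {z} → z ∈ x ∷ xs → f y ≤ f z)
minimiser f x xs = argmin f x xs , argmin-all f (here refl) (All.tabulate there) , minimal
  where
  minimal : ∀ {z} → z ∈ x ∷ xs → f (argmin f x xs) ≤ f z
  minimal (here refl) = f[argmin]≤f[⊤] {f = f} x xs
  minimal (there z∈xs) = All.lookup (f[argmin]≤f[xs] {f = f} x xs) z∈xs

non-intersecting-case : ∀ {n} t (𝒜 : List (Subset n)) {A B} → A ∈ 𝒜 → B ∈ 𝒜 →
  ∣ A ∩ B ∣ < t → Σ (List (Subset n)) (GoodSubfamily t 𝒜)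
non-intersecting-case {n} t 𝒜 {A} {B} A∈𝒜 B∈𝒜 A∩B<t =
  A ∷ B ∷ [] , s≤s (s≤s z≤n) , A∈𝒜 ∷ B∈𝒜 ∷ [] , size , gains
  where
  size : + ∣ ⋃ (A ∷ B ∷ []) ∣ ≤ℤ m (maxSize 𝒜) t
  size = i≤j⇒i≤j⊔k _ (+≤+ (∣⋃∣≤length*r (A ∷ B ∷ []) (maxSize-bound 𝒜 A∈𝒜 ∷ maxSize-bound 𝒜 B∈𝒜 ∷ [])))
  gains : (T : Subset n) → Transversal t 𝒜 T → TIntersects (suc t) T (⋃ (A ∷ B ∷ []))
  gains T meets = transversal-gains T (A ∷ B ∷ []) (here refl)
    (All.lookup meets A∈𝒜 ∷ All.lookup meets B∈𝒜 ∷ [])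
    (subst (_< t) (sym (∣⋂-pair∣ A B)) A∩B<t)

intersecting-case : ∀ {n} t → 1 ≤ t → (A₁ : Subset n) (rest : List (Subset n)) →
  TIntersecting t (A₁ ∷ rest) → ∣ ⋂ (A₁ ∷ rest) ∣ < t →
  Σ (List (Subset n)) (GoodSubfamily t (A₁ ∷ rest))
intersecting-case {n} t 1≤t A₁ rest pairwise small with minimiser (λ B → ∣ B ∩ A₁ ∣) A₁ rest
... | B₁ , B₁∈𝒜 , minimal
  with greedy-shrink (A₁ ∷ rest) small (B₁ ∷ A₁ ∷ []) (subst (t ≤_) (sym (∣⋂-pair∣ B₁ A₁)) (pairwise B₁∈𝒜 (here refl)))
... | Bs , Bs⊆𝒜 , below , count = Bs ++ L₀ , two-sets , members , size , gains
  where
  𝒜 L₀ : List (Subset n)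
  𝒜 = A₁ ∷ rest
  L₀ = B₁ ∷ A₁ ∷ []
  r c : ℕ
  r = maxSize 𝒜
  c = ∣ B₁ ∩ A₁ ∣
  two-sets : 2 ≤ length (Bs ++ L₀)
  two-sets = subst (2 ≤_) (sym (length-++ Bs)) (m≤n+m 2 (length Bs))
  members : All (_∈ 𝒜) (Bs ++ L₀)
  members = ++⁺ Bs⊆𝒜 (B₁∈𝒜 ∷ here refl ∷ [])
  base : ∣ ⋃ L₀ ∣ + c ≤ r + r
  base = ≤-trans
    (union-step B₁ (A₁ ∪ ⊥) (maxSize-bound 𝒜 B₁∈𝒜) (p⊆q⇒∣p∣≤∣q∣ (∩-monoʳ-⊆ B₁ (p⊆p∪q ⊥))))
    (+-monoʳ-≤ r (≤-trans (≤-reflexive (cong ∣_∣ (∪-identityʳ A₁))) (maxSize-bound 𝒜 (here refl))))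
  growth : ∣ ⋃ (Bs ++ L₀) ∣ + length Bs * c ≤ ∣ ⋃ L₀ ∣ + length Bs * r
  growth = union-growth Bs L₀ (there (here refl))
    (All.map (λ B∈𝒜 → maxSize-bound 𝒜 B∈𝒜 , minimal B∈𝒜) Bs⊆𝒜)
  size : + ∣ ⋃ (Bs ++ L₀) ∣ ≤ℤ m r t
  size = size-bound 1≤t (pairwise B₁∈𝒜 (here refl))
    (≤-trans (p⊆q⇒∣p∣≤∣q∣ (p∩q⊆p B₁ A₁)) (maxSize-bound 𝒜 B₁∈𝒜))
    (subst (λ k → length Bs + t ≤ suc k) (∣⋂-pair∣ B₁ A₁) count) growth base
  gains : (T : Subset n) → Transversal t 𝒜 T → TIntersects (suc t) T (⋃ (Bs ++ L₀))
  gains T meets = transversal-gains T (Bs ++ L₀) (∈-++⁺ʳ Bs (here refl))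
    (All.map (All.lookup meets) members) below

lemma3p3 : (n t : ℕ) → 1 ≤ t → (𝒜 : List (Subset n)) → Unique 𝒜 → 1 < length 𝒜 →
    ¬ TrivialTIntersecting t 𝒜 →
    Σ (List (Subset n)) (λ As → 2 ≤ length As × All (_∈ 𝒜) As
      × (+ ∣ ⋃ As ∣ ≤ℤ m (maxSize 𝒜) t)
      × ((T : Subset n) → Transversal t 𝒜 T → TIntersects (suc t) T (⋃ As)))
lemma3p3 n t 1≤t [] _ () _
lemma3p3 n t 1≤t (A₁ ∷ rest) _ _ nontrivial with intersecting-or-witness t (A₁ ∷ rest)
... | inj₂ (A , B , A∈𝒜 , B∈𝒜 , A∩B<t) = non-intersecting-case t (A₁ ∷ rest) A∈𝒜 B∈𝒜 A∩B<t
... | inj₁ pairwise =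
  intersecting-case t 1≤t A₁ rest pairwise (≰⇒> λ t≤⋂𝒜 → nontrivial (pairwise , t≤⋂𝒜))
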